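{- Let $A$ be the almost Riordan array $$A=\left(\frac{1+2x}{1-x^2};\ \frac{1}{(x-1)(1+x)^2},\ \frac{x}{1+x}\right).$$ Then $A^2$ is the Riordan array $$A^2=\left(\frac{1+x}{(1-x)(1+2x)},\ \frac{x}{1+2x}\right).$$
   Context: For a power series $u$ with $u(0)\ne0$ and $v$ with $v(0)=0$, $v'(0)\ne0$, the Riordan array $(u(x),v(x))$ is the infinite lower-triangular matrix with $(n,k)$-entry $[x^n]u(x)v(x)^k$ ($n,k\ge0$). An almost Riordan array (of first order) $(a(x);u(x),v(x))$, where $a(0)\ne0$, is the infinite lower-triangular matrix $(m_{n,k})_{n,k\ge0}$ whose column $0$ is given by $m_{n,0}=[x^n]a(x)$ and whose remaining entries are $m_{n,k}=[x^{n-1}]u(x)v(x)^{k-1}$ for $n,k\ge1$ (with $m_{0,k}=0$ for $k\ge1$); i.e. deleting the first row and first column leaves the Riordan array $(u(x),v(x))$. For example, $A$ begins with rows $(1),(2,-1),(1,1,-1),(2,-2,2,-1),(1,2,-4,3,-1)$. -}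

module Defs where

open import Data.Nat using (ℕ; zero; suc; _∸_)
open import Data.Integer using (ℤ; +_; -_; _+_; _*_)
open import Data.List using (List; []; _∷_)

Series : Set
Series = ℕ → ℤ

_≈ˢ_ : Series → Series → Set
f ≈ˢ g = ∀ n → f n ≡ g n
  where open import Relation.Binary.PropositionalEquality using (_≡_)

sumTo : ℕ → (ℕ → ℤ) → ℤ
sumTo zero    f = f 0
sumTo (suc n) f = sumTo n f + f (suc n)

_⊛_ : Series → Series → Series
(f ⊛ g) n = sumTo n (λ i → f i * g (n ∸ i))
infixl 7 _⊛_

oneˢ : Series
oneˢ zero    = + 1
oneˢ (suc _) = + 0

powˢ : Series → ℕ → Series
powˢ v zero    = oneˢ
powˢ v (suc k) = v ⊛ powˢ v k

poly : List ℤ → Series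
poly []       n       = + 0
poly (c ∷ cs) zero    = c
poly (c ∷ cs) (suc n) = poly cs n

-- Infinite matrices (indexed by row, column)
Matrix : Set
Matrix = ℕ → ℕ → ℤ

riordan : Series → Series → Matrix
riordan u v n k = (u ⊛ powˢ v k) n

almostRiordan : Series → Series → Series → Matrix
almostRiordan a u v n       zero    = a n
almostRiordan a u v zero    (suc k) = + 0
almostRiordan a u v (suc n) (suc k) = riordan u v n k

-- Product of lower-triangular infinite matrices:
-- (M N)_{n,k} = Σ_{j=0}^{n} M_{n,j} N_{j,k}  (M_{n,j} = 0 for j > n)
_⊠_ : Matrix → Matrix → Matrix
(M ⊠ N) n k = sumTo n (λ j → M n j * N j k)

-- Both sides are determined by their first row (1, 0, 0, …) and a recurrence down the columns.
-- Since v = x/(1 + x) and (1 + x) u = a − 2/(1 − x), the almost Riordan array A satisfies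
-- A(n+1,0) + A(n,0) = 3 and A(n+1,k+1) + A(n,k+1) = A(n,k) − 2[k = 0]; in particular every row
-- of A sums to 1. Summing these relations against a column of A shows that M = A² satisfies
-- M(n+1,0) + 2M(n,0) = 2 and M(n+1,k+1) + 2M(n,k+1) = M(n,k), which are exactly the recurrences
-- of the Riordan array (p, x/(1 + 2x)).
module Submission where

open import Defs
open import Data.Integer using (ℤ; +_; -_)
open import Data.List using ([]; _∷_)
open import Relation.Binary.PropositionalEquality using (_≡_)

open import Algebra.Bundles using (AbelianGroup)
open import Data.Integer using (_+_; _*_; _-_)
open import Data.Integer.Properties
  using (+-0-abelianGroup; +-assoc; +-comm; +-identityˡ; +-identityʳ; *-assoc; *-distribˡ-+; *-distribʳ-+;
         *-identityˡ; *-identityʳ; *-zeroʳ)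
open import Data.Integer.Tactic.RingSolver using (solve-∀)
open import Data.Nat using (ℕ; zero; suc; _∸_; _≤_; _<_; z≤n; s≤s)
open import Data.Nat.Properties using (+-∸-assoc; n∸n≡0; m≤n⇒m≤1+n; ≤-refl; m<n⇒m<1+n)
open import Data.Product using (_×_; _,_; proj₁; proj₂)
open import Relation.Binary.PropositionalEquality
  using (refl; sym; trans; cong; cong₂; module ≡-Reasoning)
open import Algebra.Properties.Group (AbelianGroup.group +-0-abelianGroup) using (∙-cancelʳ)

open ≡-Reasoning

sumTo-cong≤ : ∀ n {f g : ℕ → ℤ} → (∀ i → i ≤ n → f i ≡ g i) → sumTo n f ≡ sumTo n g
sumTo-cong≤ zero    f≡g = f≡g 0 z≤n
sumTo-cong≤ (suc n) f≡g =
  cong₂ _+_ (sumTo-cong≤ n (λ i i≤n → f≡g i (m≤n⇒m≤1+n i≤n))) (f≡g (suc n) ≤-refl)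

sumTo-cong : ∀ n {f g : ℕ → ℤ} → (∀ i → f i ≡ g i) → sumTo n f ≡ sumTo n g
sumTo-cong n f≡g = sumTo-cong≤ n (λ i _ → f≡g i)

sumTo-+ : ∀ n (f g : ℕ → ℤ) → sumTo n (λ i → f i + g i) ≡ sumTo n f + sumTo n g
sumTo-+ zero    f g = refl
sumTo-+ (suc n) f g =
  trans (cong (_+ (f (suc n) + g (suc n))) (sumTo-+ n f g))
        (interchange (sumTo n f) (sumTo n g) (f (suc n)) (g (suc n)))
  where
  interchange : ∀ w x y z → (w + x) + (y + z) ≡ (w + y) + (x + z)
  interchange = solve-∀

sumTo-*ˡ : ∀ n c (f : ℕ → ℤ) → sumTo n (λ i → c * f i) ≡ c * sumTo n f
sumTo-*ˡ zero    c f = refl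
sumTo-*ˡ (suc n) c f =
  trans (cong (_+ c * f (suc n)) (sumTo-*ˡ n c f)) (sym (*-distribˡ-+ c (sumTo n f) (f (suc n))))

sumTo-suc : ∀ n (f : ℕ → ℤ) → sumTo (suc n) f ≡ f 0 + sumTo n (λ i → f (suc i))
sumTo-suc zero    f = refl
sumTo-suc (suc n) f =
  trans (cong (_+ f (suc (suc n))) (sumTo-suc n f))
        (+-assoc (f 0) (sumTo n (λ i → f (suc i))) (f (suc (suc n))))

sumTo-zero : ∀ n → sumTo n (λ _ → + 0) ≡ + 0
sumTo-zero zero    = refl
sumTo-zero (suc n) = trans (+-identityʳ _) (sumTo-zero n)

impulse : ℤ → ℕ → ℤ
impulse ε zero    = ε
impulse ε (suc _) = + 0

sumTo-impulse : ∀ ε n (f : ℕ → ℤ) → sumTo n (λ i → impulse ε i * f i) ≡ ε * f 0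
sumTo-impulse ε zero    f = refl
sumTo-impulse ε (suc n) f = trans (+-identityʳ _) (sumTo-impulse ε n f)

sumTo-poly₂ : ∀ n a b → sumTo (suc n) (poly (a ∷ b ∷ [])) ≡ a + b
sumTo-poly₂ zero    a b = refl
sumTo-poly₂ (suc n) a b = trans (+-identityʳ _) (sumTo-poly₂ n a b)

≈ˢ-sym : {f g : Series} → f ≈ˢ g → g ≈ˢ f
≈ˢ-sym f≈g n = sym (f≈g n)

≈ˢ-trans : {f g h : Series} → f ≈ˢ g → g ≈ˢ h → f ≈ˢ h
≈ˢ-trans f≈g g≈h n = trans (f≈g n) (g≈h n)

⊛-congˡ : ∀ {f g} h → f ≈ˢ g → (f ⊛ h) ≈ˢ (g ⊛ h)
⊛-congˡ h f≈g n = sumTo-cong n (λ i → cong (_* h (n ∸ i)) (f≈g i))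

⊛-congʳ : ∀ f {g h} → g ≈ˢ h → (f ⊛ g) ≈ˢ (f ⊛ h)
⊛-congʳ f g≈h n = sumTo-cong n (λ i → cong (f i *_) (g≈h (n ∸ i)))

⊛-identityˡ : ∀ f → (oneˢ ⊛ f) ≈ˢ f
⊛-identityˡ f zero    = *-identityˡ (f 0)
⊛-identityˡ f (suc m) = begin
  (oneˢ ⊛ f) (suc m)                   ≡⟨ sumTo-suc m _ ⟩
  + 1 * f (suc m) + sumTo m (λ _ → + 0) ≡⟨ cong (λ t → + 1 * f (suc m) + t) (sumTo-zero m) ⟩
  + 1 * f (suc m) + + 0                 ≡⟨ trans (+-identityʳ _) (*-identityˡ _) ⟩
  f (suc m)                             ∎

⊛-identityʳ : ∀ f → (f ⊛ oneˢ) ≈ˢ f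
⊛-identityʳ f zero    = *-identityʳ (f 0)
⊛-identityʳ f (suc m) = begin
  sumTo m (λ i → f i * oneˢ (suc m ∸ i)) + f (suc m) * oneˢ (m ∸ m)
    ≡⟨ cong₂ _+_ (trans (sumTo-cong≤ m vanish) (sumTo-zero m))
                 (cong (λ j → f (suc m) * oneˢ j) (n∸n≡0 m)) ⟩
  + 0 + f (suc m) * + 1
    ≡⟨ trans (+-identityˡ _) (*-identityʳ _) ⟩
  f (suc m) ∎
  where
  vanish : ∀ i → i ≤ m → f i * oneˢ (suc m ∸ i) ≡ + 0
  vanish i i≤m = trans (cong (λ j → f i * oneˢ j) (+-∸-assoc 1 i≤m)) (*-zeroʳ (f i))

mulLinear : ℤ → ℤ → Series → Series
mulLinear a b f zero    = a * f 0
mulLinear a b f (suc n) = a * f (suc n) + b * f n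

mulLinear-cong : ∀ a b {f g} → f ≈ˢ g → mulLinear a b f ≈ˢ mulLinear a b g
mulLinear-cong a b f≈g zero    = cong (a *_) (f≈g 0)
mulLinear-cong a b f≈g (suc n) = cong₂ _+_ (cong (a *_) (f≈g (suc n))) (cong (b *_) (f≈g n))

mulLinear-comm : ∀ a b c d f →
  mulLinear a b (mulLinear c d f) ≈ˢ mulLinear c d (mulLinear a b f)
mulLinear-comm a b c d f zero          = comm₀ a c (f 0)
  where
  comm₀ : ∀ a c x → a * (c * x) ≡ c * (a * x)
  comm₀ = solve-∀
mulLinear-comm a b c d f (suc zero)    = comm₁ a b c d (f 1) (f 0)
  where
  comm₁ : ∀ a b c d x y → a * (c * x + d * y) + b * (c * y) ≡ c * (a * x + b * y) + d * (a * y)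
  comm₁ = solve-∀
mulLinear-comm a b c d f (suc (suc n)) = comm₂ a b c d (f (suc (suc n))) (f (suc n)) (f n)
  where
  comm₂ : ∀ a b c d x y z →
    a * (c * x + d * y) + b * (c * y + d * z) ≡ c * (a * x + b * y) + d * (a * y + b * z)
  comm₂ = solve-∀

⊛-mulLinear : ∀ a b f g → (f ⊛ mulLinear a b g) ≈ˢ mulLinear a b (f ⊛ g)
⊛-mulLinear a b f g zero    = swap (f 0) a (g 0)
  where
  swap : ∀ x a y → x * (a * y) ≡ a * (x * y)
  swap = solve-∀
⊛-mulLinear a b f g (suc m) = begin
  sumTo m (λ i → f i * L (suc m ∸ i)) + f (suc m) * L (m ∸ m)
    ≡⟨ cong₂ _+_ (sumTo-cong≤ m inner) last ⟩
  sumTo m (λ i → a * (f i * g (suc m ∸ i)) + b * (f i * g (m ∸ i))) + a * (f (suc m) * g (m ∸ m))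
    ≡⟨ cong (_+ a * (f (suc m) * g (m ∸ m)))
            (trans (sumTo-+ m _ _) (cong₂ _+_ (sumTo-*ˡ m a _) (sumTo-*ˡ m b _))) ⟩
  (a * S₁ + b * S₂) + a * (f (suc m) * g (m ∸ m))
    ≡⟨ regroup a b S₁ S₂ _ ⟩
  a * (S₁ + f (suc m) * g (m ∸ m)) + b * S₂ ∎
  where
  L  = mulLinear a b g
  S₁ = sumTo m (λ i → f i * g (suc m ∸ i))
  S₂ = sumTo m (λ i → f i * g (m ∸ i))
  distrib : ∀ a b x y z → x * (a * y + b * z) ≡ a * (x * y) + b * (x * z)
  distrib = solve-∀
  swap : ∀ x a y → x * (a * y) ≡ a * (x * y)
  swap = solve-∀
  regroup : ∀ a b s t u → (a * s + b * t) + a * u ≡ a * (s + u) + b * t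
  regroup = solve-∀
  inner : ∀ i → i ≤ m → f i * L (suc m ∸ i) ≡ a * (f i * g (suc m ∸ i)) + b * (f i * g (m ∸ i))
  inner i i≤m = begin
    f i * L (suc m ∸ i)
      ≡⟨ cong (λ j → f i * L j) (+-∸-assoc 1 i≤m) ⟩
    f i * (a * g (suc (m ∸ i)) + b * g (m ∸ i))
      ≡⟨ distrib a b (f i) _ _ ⟩
    a * (f i * g (suc (m ∸ i))) + b * (f i * g (m ∸ i))
      ≡⟨ cong (λ j → a * (f i * g j) + b * (f i * g (m ∸ i))) (sym (+-∸-assoc 1 i≤m)) ⟩
    a * (f i * g (suc m ∸ i)) + b * (f i * g (m ∸ i)) ∎
  last : f (suc m) * L (m ∸ m) ≡ a * (f (suc m) * g (m ∸ m))
  last = begin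
    f (suc m) * L (m ∸ m)       ≡⟨ cong (λ j → f (suc m) * L j) (n∸n≡0 m) ⟩
    f (suc m) * (a * g 0)       ≡⟨ swap (f (suc m)) a (g 0) ⟩
    a * (f (suc m) * g 0)       ≡⟨ cong (λ j → a * (f (suc m) * g j)) (sym (n∸n≡0 m)) ⟩
    a * (f (suc m) * g (m ∸ m)) ∎

mulLinear-⊛ : ∀ a b f g → (mulLinear a b f ⊛ g) ≈ˢ mulLinear a b (f ⊛ g)
mulLinear-⊛ a b f g zero    = *-assoc a (f 0) (g 0)
mulLinear-⊛ a b f g (suc m) = begin
  (mulLinear a b f ⊛ g) (suc m)
    ≡⟨ sumTo-suc m _ ⟩
  a * f 0 * g (suc m) + sumTo m (λ i → (a * f (suc i) + b * f i) * g (m ∸ i))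
    ≡⟨ cong₂ _+_ (*-assoc a (f 0) (g (suc m)))
         (trans (sumTo-cong m (λ i → distrib a b (f (suc i)) (f i) (g (m ∸ i))))
           (trans (sumTo-+ m _ _) (cong₂ _+_ (sumTo-*ˡ m a _) (sumTo-*ˡ m b _)))) ⟩
  a * (f 0 * g (suc m)) + (a * S₁ + b * S₂)
    ≡⟨ regroup a b _ S₁ S₂ ⟩
  a * (f 0 * g (suc m) + S₁) + b * S₂
    ≡⟨ cong (λ t → a * t + b * S₂) (sym (sumTo-suc m (λ i → f i * g (suc m ∸ i)))) ⟩
  mulLinear a b (f ⊛ g) (suc m) ∎
  where
  S₁ = sumTo m (λ i → f (suc i) * g (m ∸ i))
  S₂ = sumTo m (λ i → f i * g (m ∸ i))
  distrib : ∀ a b x y z → (a * x + b * y) * z ≡ a * (x * z) + b * (y * z)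
  distrib = solve-∀
  regroup : ∀ a b u s t → a * u + (a * s + b * t) ≡ a * (u + s) + b * t
  regroup = solve-∀

poly₂≈mulLinear : ∀ a b → poly (a ∷ b ∷ []) ≈ˢ mulLinear a b oneˢ
poly₂≈mulLinear a b zero          = sym (*-identityʳ a)
poly₂≈mulLinear a b (suc zero)    =
  sym (trans (cong (_+ b * + 1) (*-zeroʳ a)) (trans (+-identityˡ _) (*-identityʳ b)))
poly₂≈mulLinear a b (suc (suc n)) = sym (cong₂ _+_ (*-zeroʳ a) (*-zeroʳ b))

⊛-poly₂ : ∀ f a b → (f ⊛ poly (a ∷ b ∷ [])) ≈ˢ mulLinear a b f
⊛-poly₂ f a b =
  ≈ˢ-trans (⊛-congʳ f (poly₂≈mulLinear a b))
    (≈ˢ-trans (⊛-mulLinear a b f oneˢ) (mulLinear-cong a b (⊛-identityʳ f)))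

poly₂-⊛ : ∀ a b g → (poly (a ∷ b ∷ []) ⊛ g) ≈ˢ mulLinear a b g
poly₂-⊛ a b g =
  ≈ˢ-trans (⊛-congˡ g (poly₂≈mulLinear a b))
    (≈ˢ-trans (mulLinear-⊛ a b oneˢ g) (mulLinear-cong a b (⊛-identityˡ g)))

⊛-⊛-poly₂ : ∀ f g a b → (f ⊛ (g ⊛ poly (a ∷ b ∷ []))) ≈ˢ mulLinear a b (f ⊛ g)
⊛-⊛-poly₂ f g a b = ≈ˢ-trans (⊛-congʳ f (⊛-poly₂ g a b)) (⊛-mulLinear a b f g)

⊛-poly₂-poly₂ : ∀ f a b c d →
  (f ⊛ (poly (a ∷ b ∷ []) ⊛ poly (c ∷ d ∷ []))) ≈ˢ mulLinear c d (mulLinear a b f)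
⊛-poly₂-poly₂ f a b c d = ≈ˢ-trans (⊛-⊛-poly₂ f (poly (a ∷ b ∷ [])) c d) (mulLinear-cong c d (⊛-poly₂ f a b))

x≡[x+y]-y : ∀ x y → x ≡ (x + y) - y
x≡[x+y]-y = solve-∀

mulLinear-1-x⇒sumTo : ∀ {g h} → mulLinear (+ 1) (- (+ 1)) g ≈ˢ h → ∀ n → g n ≡ sumTo n h
mulLinear-1-x⇒sumTo {g} {h} eq zero    = trans (sym (*-identityˡ (g 0))) (eq 0)
mulLinear-1-x⇒sumTo {g} {h} eq (suc n) = begin
  g (suc n)                                           ≡⟨ undo (g (suc n)) (g n) ⟩
  (+ 1 * g (suc n) + - (+ 1) * g n) + g n             ≡⟨ cong₂ _+_ (eq (suc n)) (mulLinear-1-x⇒sumTo eq n) ⟩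
  h (suc n) + sumTo n h                               ≡⟨ +-comm (h (suc n)) (sumTo n h) ⟩
  sumTo n h + h (suc n)                               ∎
  where
  undo : ∀ x y → x ≡ (+ 1 * x + - (+ 1) * y) + y
  undo = solve-∀

quotient-coefficients : ∀ c d f →
  (f ⊛ (poly (+ 1 ∷ - (+ 1) ∷ []) ⊛ poly (+ 1 ∷ c ∷ []))) ≈ˢ poly (+ 1 ∷ d ∷ []) →
  f 0 ≡ + 1 × (∀ n → f (suc n) + c * f n ≡ + 1 + d)
quotient-coefficients c d f hyp = f₀ , f-rec
  where
  partialSums : ∀ n → mulLinear (+ 1) c f n ≡ sumTo n (poly (+ 1 ∷ d ∷ []))
  partialSums = mulLinear-1-x⇒sumTo
    (≈ˢ-trans (mulLinear-comm (+ 1) (- (+ 1)) (+ 1) c f)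
      (≈ˢ-trans (≈ˢ-sym (⊛-poly₂-poly₂ f (+ 1) (- (+ 1)) (+ 1) c)) hyp))
  f₀ : f 0 ≡ + 1
  f₀ = trans (sym (*-identityˡ (f 0))) (partialSums 0)
  f-rec : ∀ n → f (suc n) + c * f n ≡ + 1 + d
  f-rec n = trans (cong (_+ c * f n) (sym (*-identityˡ (f (suc n)))))
                  (trans (partialSums (suc n)) (sumTo-poly₂ n (+ 1) d))

mulLinear-x-1⇒constant : ∀ {y} → mulLinear (- (+ 1)) (+ 1) y ≈ˢ oneˢ → ∀ n → y n ≡ - (+ 1)
mulLinear-x-1⇒constant {y} eq zero    = trans (negate (y 0)) (cong (- (+ 1) *_) (eq 0))
  where
  negate : ∀ x → x ≡ - (+ 1) * (- (+ 1) * x)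
  negate = solve-∀
mulLinear-x-1⇒constant {y} eq (suc n) =
  trans (undo (y (suc n)) (y n)) (cong₂ (λ s t → - (+ 1) * s + t) (eq (suc n)) (mulLinear-x-1⇒constant eq n))
  where
  undo : ∀ x z → x ≡ - (+ 1) * (- (+ 1) * x + + 1 * z) + z
  undo = solve-∀

-- (x − 1)(1 + x)² u = 1 and (1 − x)(1 + x) a = 1 + 2x give (1 + x) u = a − 2/(1 − x).
u⊛[1+x]≈a-2 : (a u : Series) → a 0 ≡ + 1 → (∀ n → a (suc n) + + 1 * a n ≡ + 3) →
  (u ⊛ (poly (- (+ 1) ∷ + 1 ∷ []) ⊛ poly (+ 1 ∷ + 1 ∷ []) ⊛ poly (+ 1 ∷ + 1 ∷ []))) ≈ˢ oneˢ →
  (u ⊛ poly (+ 1 ∷ + 1 ∷ [])) ≈ˢ (λ n → a n + - (+ 2))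
u⊛[1+x]≈a-2 a u a₀ a-rec hyp = ≈ˢ-trans (⊛-poly₂ u (+ 1) (+ 1)) w≈a-2
  where
  w = mulLinear (+ 1) (+ 1) u
  y = mulLinear (+ 1) (+ 1) w
  y≈-1 : ∀ n → y n ≡ - (+ 1)
  y≈-1 = mulLinear-x-1⇒constant
    (≈ˢ-trans (≈ˢ-sym (mulLinear-comm (+ 1) (+ 1) (- (+ 1)) (+ 1) w))
      (≈ˢ-trans (mulLinear-cong (+ 1) (+ 1) (≈ˢ-sym (mulLinear-comm (+ 1) (+ 1) (- (+ 1)) (+ 1) u)))
        (≈ˢ-trans (≈ˢ-sym (≈ˢ-trans (⊛-⊛-poly₂ u (poly (- (+ 1) ∷ + 1 ∷ []) ⊛ poly (+ 1 ∷ + 1 ∷ [])) (+ 1) (+ 1))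
                            (mulLinear-cong (+ 1) (+ 1) (⊛-poly₂-poly₂ u (- (+ 1)) (+ 1) (+ 1) (+ 1)))))
          hyp)))
  w≈a-2 : ∀ n → w n ≡ a n + - (+ 2)
  w≈a-2 zero    = trans (sym (*-identityˡ (w 0))) (trans (y≈-1 0) (cong (_+ - (+ 2)) (sym a₀)))
  w≈a-2 (suc n) = begin
    w (suc n)                                    ≡⟨ undo (w (suc n)) (w n) ⟩
    y (suc n) - w n                              ≡⟨ cong₂ _-_ (y≈-1 (suc n)) (w≈a-2 n) ⟩
    - (+ 1) - (a n + - (+ 2))                    ≡⟨ reflect (a n) ⟩
    (+ 3 - + 1 * a n) + - (+ 2)                  ≡⟨ cong (λ t → (t - + 1 * a n) + - (+ 2)) (sym (a-rec n)) ⟩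
    ((a (suc n) + + 1 * a n) - + 1 * a n) + - (+ 2) ≡⟨ cong (_+ - (+ 2)) (sym (x≡[x+y]-y (a (suc n)) (+ 1 * a n))) ⟩
    a (suc n) + - (+ 2)                          ∎
    where
    undo : ∀ x z → x ≡ (+ 1 * x + + 1 * z) - z
    undo = solve-∀
    reflect : ∀ x → - (+ 1) - (x + - (+ 2)) ≡ (+ 3 - + 1 * x) + - (+ 2)
    reflect = solve-∀

_⊡_ : Matrix → Series → Series
(M ⊡ f) n = sumTo n (λ j → M n j * f j)
infixl 7 _⊡_

column : Matrix → ℕ → Series
column M k n = M n k

⊡-congʳ : ∀ M {f g} → f ≈ˢ g → (M ⊡ f) ≈ˢ (M ⊡ g)
⊡-congʳ M f≈g n = sumTo-cong n (λ j → cong (M n j *_) (f≈g j))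

⊡-+ : ∀ M f g → (M ⊡ (λ m → f m + g m)) ≈ˢ (λ n → (M ⊡ f) n + (M ⊡ g) n)
⊡-+ M f g n =
  trans (sumTo-cong n (λ j → *-distribˡ-+ (M n j) (f j) (g j))) (sumTo-+ n _ _)

⊡-*ˡ : ∀ M c f → (M ⊡ (λ m → c * f m)) ≈ˢ (λ n → c * (M ⊡ f) n)
⊡-*ˡ M c f n = trans (sumTo-cong n (λ j → swap (M n j) c (f j))) (sumTo-*ˡ n c _)
  where
  swap : ∀ x c y → x * (c * y) ≡ c * (x * y)
  swap = solve-∀

record Recurrence (c d : ℤ) (e : ℕ → ℤ) (M : Matrix) : Set where
  field
    corner : M 0 0 ≡ + 1
    top    : ∀ k → M 0 (suc k) ≡ + 0
    first  : ∀ n → M (suc n) 0 + c * M n 0 ≡ d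
    next   : ∀ n k → M (suc n) (suc k) + c * M n (suc k) ≡ M n k + e k

Recurrence-unique : ∀ {c d e M N} → Recurrence c d e M → Recurrence c d e N →
  ∀ n k → M n k ≡ N n k
Recurrence-unique {c} {d} {e} {M} {N} recM recN = go
  where
  module M = Recurrence recM
  module N = Recurrence recN
  go : ∀ n k → M n k ≡ N n k
  go zero    zero    = trans M.corner (sym N.corner)
  go zero    (suc k) = trans (M.top k) (sym (N.top k))
  go (suc n) zero    = ∙-cancelʳ (c * N n 0) _ _ (begin
    M (suc n) 0 + c * N n 0  ≡⟨ cong (λ t → M (suc n) 0 + c * t) (sym (go n 0)) ⟩
    M (suc n) 0 + c * M n 0  ≡⟨ M.first n ⟩
    d                        ≡⟨ sym (N.first n) ⟩
    N (suc n) 0 + c * N n 0  ∎)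
  go (suc n) (suc k) = ∙-cancelʳ (c * N n (suc k)) _ _ (begin
    M (suc n) (suc k) + c * N n (suc k)  ≡⟨ cong (λ t → M (suc n) (suc k) + c * t) (sym (go n (suc k))) ⟩
    M (suc n) (suc k) + c * M n (suc k)  ≡⟨ M.next n k ⟩
    M n k + e k                          ≡⟨ cong (_+ e k) (go n k) ⟩
    N n k + e k                          ≡⟨ sym (N.next n k) ⟩
    N (suc n) (suc k) + c * N n (suc k)  ∎)

Recurrence-triangular : ∀ {c d e M} → Recurrence c d e M → (∀ k → e (suc k) ≡ + 0) →
  ∀ {n k} → n < k → M n k ≡ + 0
Recurrence-triangular {c} {_} {e} {M} rec e-tail = go
  where
  open Recurrence rec
  go : ∀ {n k} → n < k → M n k ≡ + 0
  go {zero}  {suc k}       _                  = top k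
  go {suc n} {suc zero}    (s≤s ())
  go {suc n} {suc (suc k)} (s≤s n<1+k) = begin
    M (suc n) (suc (suc k))
      ≡⟨ x≡[x+y]-y _ _ ⟩
    (M (suc n) (suc (suc k)) + c * M n (suc (suc k))) - c * M n (suc (suc k))
      ≡⟨ cong₂ (λ s t → s - c * t) (next n (suc k)) (go (m<n⇒m<1+n n<1+k)) ⟩
    (M n (suc k) + e (suc k)) - c * + 0
      ≡⟨ cong₂ (λ s t → (s + t) - c * + 0) (go n<1+k) (e-tail k) ⟩
    + 0 - c * + 0
      ≡⟨ cong (λ t → + 0 - t) (*-zeroʳ c) ⟩
    + 0 ∎

⊡-suc : ∀ {c d e M} → Recurrence c d e M → (∀ n → M n (suc n) ≡ + 0) → ∀ f n →
  (M ⊡ f) (suc n) + c * (M ⊡ f) n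
    ≡ d * f 0 + ((M ⊡ (λ m → f (suc m))) n + sumTo n (λ m → e m * f (suc m)))
⊡-suc {c} {d} {e} {M} rec diagonal f n = begin
  (M ⊡ f) (suc n) + c * (M ⊡ f) n
    ≡⟨ cong (λ t → (M ⊡ f) (suc n) + c * t) extend ⟩
  sumTo (suc n) (λ j → M (suc n) j * f j) + c * sumTo (suc n) (λ j → M n j * f j)
    ≡⟨ cong (λ t → sumTo (suc n) (λ j → M (suc n) j * f j) + t) (sym (sumTo-*ˡ (suc n) c _)) ⟩
  sumTo (suc n) (λ j → M (suc n) j * f j) + sumTo (suc n) (λ j → c * (M n j * f j))
    ≡⟨ sym (sumTo-+ (suc n) _ _) ⟩
  sumTo (suc n) (λ j → M (suc n) j * f j + c * (M n j * f j))
    ≡⟨ sumTo-cong (suc n) (λ j → factor (M (suc n) j) c (M n j) (f j)) ⟩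
  sumTo (suc n) (λ j → (M (suc n) j + c * M n j) * f j)
    ≡⟨ sumTo-suc n _ ⟩
  (M (suc n) 0 + c * M n 0) * f 0 + sumTo n (λ m → (M (suc n) (suc m) + c * M n (suc m)) * f (suc m))
    ≡⟨ cong₂ _+_ (cong (_* f 0) (first n)) (sumTo-cong n (λ m → cong (_* f (suc m)) (next n m))) ⟩
  d * f 0 + sumTo n (λ m → (M n m + e m) * f (suc m))
    ≡⟨ cong (λ t → d * f 0 + t)
            (trans (sumTo-cong n (λ m → *-distribʳ-+ (f (suc m)) (M n m) (e m))) (sumTo-+ n _ _)) ⟩
  d * f 0 + ((M ⊡ (λ m → f (suc m))) n + sumTo n (λ m → e m * f (suc m))) ∎
  where
  open Recurrence rec
  extend : (M ⊡ f) n ≡ sumTo (suc n) (λ j → M n j * f j)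
  extend = sym (trans (cong (λ t → (M ⊡ f) n + t * f (suc n)) (diagonal n)) (+-identityʳ _))
  factor : ∀ x c y z → x * z + c * (y * z) ≡ (x + c * y) * z
  factor = solve-∀

module SquareRecurrence {A : Matrix} (rec : Recurrence (+ 1) (+ 3) (impulse (- (+ 2))) A) where
  open Recurrence rec

  diagonal : ∀ n → A n (suc n) ≡ + 0
  diagonal n = Recurrence-triangular rec (λ _ → refl) ≤-refl

  ⊡-suc′ : ∀ f n → (A ⊡ f) (suc n) + + 1 * (A ⊡ f) n
                     ≡ + 3 * f 0 + ((A ⊡ (λ m → f (suc m))) n + - (+ 2) * f 1)
  ⊡-suc′ f n =
    trans (⊡-suc rec diagonal f n)
          (cong (λ t → + 3 * f 0 + ((A ⊡ (λ m → f (suc m))) n + t)) (sumTo-impulse _ n _))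

  rowSum : ∀ n → (A ⊡ (λ _ → + 1)) n ≡ + 1
  rowSum zero    = trans (*-identityʳ (A 0 0)) corner
  rowSum (suc n) = begin
    r (suc n)                                        ≡⟨ x≡[x+y]-y (r (suc n)) (+ 1 * r n) ⟩
    (r (suc n) + + 1 * r n) - + 1 * r n              ≡⟨ cong (λ t → t - + 1 * r n) (⊡-suc′ (λ _ → + 1) n) ⟩
    (+ 3 * + 1 + (r n + - (+ 2) * + 1)) - + 1 * r n  ≡⟨ collapse (r n) ⟩
    + 1                                              ∎
    where
    r = A ⊡ (λ _ → + 1)
    collapse : ∀ x → (+ 3 * + 1 + (x + - (+ 2) * + 1)) - + 1 * x ≡ + 1
    collapse = solve-∀

  ⊡-const : ∀ x n → (A ⊡ (λ _ → x)) n ≡ x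
  ⊡-const x n = begin
    (A ⊡ (λ _ → x)) n        ≡⟨ ⊡-congʳ A (λ _ → sym (*-identityʳ x)) n ⟩
    (A ⊡ (λ _ → x * + 1)) n  ≡⟨ ⊡-*ˡ A x (λ _ → + 1) n ⟩
    x * (A ⊡ (λ _ → + 1)) n  ≡⟨ cong (x *_) (rowSum n) ⟩
    x * + 1                  ≡⟨ *-identityʳ x ⟩
    x                        ∎

  ⊡-+const : ∀ f x n → (A ⊡ (λ m → f m + x)) n ≡ (A ⊡ f) n + x
  ⊡-+const f x n = trans (⊡-+ A f (λ _ → x) n) (cong (λ t → (A ⊡ f) n + t) (⊡-const x n))

  Δ : Series → Series
  Δ f m = f (suc m) + + 1 * f m

  ⊡-suc+2* : ∀ f n → (A ⊡ f) (suc n) + + 2 * (A ⊡ f) n ≡ + 5 * f 0 + ((A ⊡ Δ f) n - + 2 * Δ f 0)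
  ⊡-suc+2* f n = begin
    F (suc n) + + 2 * F n
      ≡⟨ split (F (suc n)) (F n) ⟩
    (F (suc n) + + 1 * F n) + + 1 * F n
      ≡⟨ cong (_+ + 1 * F n) (⊡-suc′ f n) ⟩
    (+ 3 * f 0 + (S + - (+ 2) * f 1)) + + 1 * F n
      ≡⟨ regroup (f 0) (f 1) S (F n) ⟩
    + 5 * f 0 + ((S + + 1 * F n) - + 2 * Δ f 0)
      ≡⟨ cong (λ t → + 5 * f 0 + (t - + 2 * Δ f 0)) (sym ⊡-Δ) ⟩
    + 5 * f 0 + ((A ⊡ Δ f) n - + 2 * Δ f 0) ∎
    where
    F = A ⊡ f
    S = (A ⊡ (λ m → f (suc m))) n
    ⊡-Δ : (A ⊡ Δ f) n ≡ S + + 1 * F n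
    ⊡-Δ = trans (⊡-+ A _ _ n) (cong (λ t → S + t) (⊡-*ˡ A (+ 1) f n))
    split : ∀ x y → x + + 2 * y ≡ (x + + 1 * y) + + 1 * y
    split = solve-∀
    regroup : ∀ f₀ f₁ s y →
      (+ 3 * f₀ + (s + - (+ 2) * f₁)) + + 1 * y ≡ + 5 * f₀ + ((s + + 1 * y) - + 2 * (f₁ + + 1 * f₀))
    regroup = solve-∀

  square-recurrence : Recurrence (+ 2) (+ 2) (λ _ → + 0) (A ⊠ A)
  square-recurrence = record
    { corner = cong₂ _*_ corner corner
    ; top    = λ k → cong₂ _*_ corner (top k)
    ; first  = first²
    ; next   = next²
    }
    where
    first² : ∀ n → (A ⊠ A) (suc n) 0 + + 2 * (A ⊠ A) n 0 ≡ + 2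
    first² n = begin
      (A ⊠ A) (suc n) 0 + + 2 * (A ⊠ A) n 0
        ≡⟨ ⊡-suc+2* (column A 0) n ⟩
      + 5 * A 0 0 + ((A ⊡ Δ (column A 0)) n - + 2 * Δ (column A 0) 0)
        ≡⟨ cong₂ (λ x y → + 5 * x + (y - + 2 * Δ (column A 0) 0))
                 corner (trans (⊡-congʳ A first n) (⊡-const (+ 3) n)) ⟩
      + 5 * + 1 + (+ 3 - + 2 * Δ (column A 0) 0)
        ≡⟨ cong (λ t → + 5 * + 1 + (+ 3 - + 2 * t)) (first 0) ⟩
      + 5 * + 1 + (+ 3 - + 2 * + 3) ∎

    balance : ∀ k → impulse (- (+ 2)) k + + 2 * A 0 k ≡ + 0
    balance zero    = cong (λ t → - (+ 2) + + 2 * t) corner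
    balance (suc k) = cong (λ t → + 0 + + 2 * t) (top k)

    next² : ∀ n k → (A ⊠ A) (suc n) (suc k) + + 2 * (A ⊠ A) n (suc k) ≡ (A ⊠ A) n k + + 0
    next² n k = begin
      (A ⊠ A) (suc n) (suc k) + + 2 * (A ⊠ A) n (suc k)
        ≡⟨ ⊡-suc+2* (column A (suc k)) n ⟩
      + 5 * A 0 (suc k) + ((A ⊡ Δ (column A (suc k))) n - + 2 * Δ (column A (suc k)) 0)
        ≡⟨ cong₂ (λ x y → + 5 * x + (y - + 2 * Δ (column A (suc k)) 0))
                 (top k) (trans (⊡-congʳ A (λ m → next m k) n) (⊡-+const (column A k) ι n)) ⟩
      + 5 * + 0 + ((A ⊠ A) n k + ι - + 2 * Δ (column A (suc k)) 0)
        ≡⟨ cong (λ t → + 5 * + 0 + ((A ⊠ A) n k + ι - + 2 * t)) (next 0 k) ⟩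
      + 5 * + 0 + ((A ⊠ A) n k + ι - + 2 * (A 0 k + ι))
        ≡⟨ simplify ((A ⊠ A) n k) ι (A 0 k) ⟩
      (A ⊠ A) n k - (ι + + 2 * A 0 k)
        ≡⟨ cong (λ t → (A ⊠ A) n k - t) (balance k) ⟩
      (A ⊠ A) n k - + 0 ∎
      where
      ι = impulse (- (+ 2)) k
      simplify : ∀ m ι a → + 5 * + 0 + (m + ι - + 2 * (a + ι)) ≡ m - (ι + + 2 * a)
      simplify = solve-∀

riordan-column : ∀ u v n → riordan u v n 0 ≡ u n
riordan-column u v = ⊛-identityʳ u

riordan-top : ∀ c u v → (v ⊛ poly (+ 1 ∷ c ∷ [])) ≈ˢ poly (+ 0 ∷ + 1 ∷ []) →
  ∀ k → riordan u v 0 (suc k) ≡ + 0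
riordan-top c u v v[1+cx]≈x k = begin
  u 0 * (v 0 * powˢ v k 0)  ≡⟨ cong (λ t → u 0 * (t * powˢ v k 0)) v₀ ⟩
  u 0 * + 0                 ≡⟨ *-zeroʳ (u 0) ⟩
  + 0                       ∎
  where
  v₀ : v 0 ≡ + 0
  v₀ = trans (sym (*-identityʳ (v 0))) (v[1+cx]≈x 0)

-- Multiplying by v = x/(1 + cx) is a shift once the factor 1 + cx is cleared.
riordan-next : ∀ c u v → (v ⊛ poly (+ 1 ∷ c ∷ [])) ≈ˢ poly (+ 0 ∷ + 1 ∷ []) →
  ∀ n k → riordan u v (suc n) (suc k) + c * riordan u v n (suc k) ≡ riordan u v n k
riordan-next c u v v[1+cx]≈x n k = begin
  h (suc n) + c * h n                            ≡⟨ cong (_+ c * h n) (sym (*-identityˡ (h (suc n)))) ⟩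
  mulLinear (+ 1) c h (suc n)                    ≡⟨ ⊛-mulLinear (+ 1) c u (v ⊛ g) (suc n) ⟨
  (u ⊛ mulLinear (+ 1) c (v ⊛ g)) (suc n)        ≡⟨ ⊛-congʳ u (mulLinear-⊛ (+ 1) c v g) (suc n) ⟨
  (u ⊛ (mulLinear (+ 1) c v ⊛ g)) (suc n)        ≡⟨ ⊛-congʳ u (⊛-congˡ g v[1+cx]≈x′) (suc n) ⟩
  (u ⊛ (poly (+ 0 ∷ + 1 ∷ []) ⊛ g)) (suc n)      ≡⟨ ⊛-congʳ u (poly₂-⊛ (+ 0) (+ 1) g) (suc n) ⟩
  (u ⊛ mulLinear (+ 0) (+ 1) g) (suc n)          ≡⟨ ⊛-mulLinear (+ 0) (+ 1) u g (suc n) ⟩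
  + 0 * (u ⊛ g) (suc n) + + 1 * (u ⊛ g) n        ≡⟨ trans (+-identityˡ _) (*-identityˡ _) ⟩
  (u ⊛ g) n                                      ∎
  where
  g = powˢ v k
  h = u ⊛ (v ⊛ g)
  v[1+cx]≈x′ : mulLinear (+ 1) c v ≈ˢ poly (+ 0 ∷ + 1 ∷ [])
  v[1+cx]≈x′ = ≈ˢ-trans (≈ˢ-sym (⊛-poly₂ v (+ 1) c)) v[1+cx]≈x

riordan-recurrence : ∀ c d p q → p 0 ≡ + 1 → (∀ n → p (suc n) + c * p n ≡ d) →
  (q ⊛ poly (+ 1 ∷ c ∷ [])) ≈ˢ poly (+ 0 ∷ + 1 ∷ []) →
  Recurrence c d (λ _ → + 0) (riordan p q)
riordan-recurrence c d p q p₀ p-rec q[1+cx]≈x = record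
  { corner = trans (riordan-column p q 0) p₀
  ; top    = riordan-top c p q q[1+cx]≈x
  ; first  = λ n → trans (cong₂ (λ s t → s + c * t) (riordan-column p q (suc n)) (riordan-column p q n))
                         (p-rec n)
  ; next   = λ n k → trans (riordan-next c p q q[1+cx]≈x n k) (sym (+-identityʳ _))
  }

almostRiordan-recurrence : ∀ c d ε a u v → a 0 ≡ + 1 → (∀ n → a (suc n) + c * a n ≡ d) →
  (u ⊛ poly (+ 1 ∷ c ∷ [])) ≈ˢ (λ n → a n + ε) →
  (v ⊛ poly (+ 1 ∷ c ∷ [])) ≈ˢ poly (+ 0 ∷ + 1 ∷ []) →
  Recurrence c d (impulse ε) (almostRiordan a u v)
almostRiordan-recurrence c d ε a u v a₀ a-rec u[1+cx] v[1+cx]≈x = record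
  { corner = a₀
  ; top    = λ _ → refl
  ; first  = a-rec
  ; next   = next
  }
  where
  next : ∀ n k → almostRiordan a u v (suc n) (suc k) + c * almostRiordan a u v n (suc k)
                   ≡ almostRiordan a u v n k + impulse ε k
  next zero    zero    = trans (cong (λ t → u 0 * + 1 + t) (*-zeroʳ c)) (trans (+-identityʳ _) (u[1+cx] 0))
  next zero    (suc k) = cong₂ _+_ (riordan-top c u v v[1+cx]≈x k) (*-zeroʳ c)
  next (suc n) zero    = begin
    riordan u v (suc n) 0 + c * riordan u v n 0 ≡⟨ cong₂ (λ s t → s + c * t) (riordan-column u v (suc n))
                                                                         (riordan-column u v n) ⟩
    u (suc n) + c * u n                          ≡⟨ cong (_+ c * u n) (sym (*-identityˡ (u (suc n)))) ⟩
    mulLinear (+ 1) c u (suc n)                  ≡⟨ ⊛-poly₂ u (+ 1) c (suc n) ⟨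
    (u ⊛ poly (+ 1 ∷ c ∷ [])) (suc n)            ≡⟨ u[1+cx] (suc n) ⟩
    a (suc n) + ε                                ∎
  next (suc n) (suc k) = trans (riordan-next c u v v[1+cx]≈x n k) (sym (+-identityʳ _))

mainTheorem15 : (a u v p q : Series) →
    (a ⊛ (poly (+ 1 ∷ - (+ 1) ∷ []) ⊛ poly (+ 1 ∷ + 1 ∷ [])))
      ≈ˢ poly (+ 1 ∷ + 2 ∷ []) →
    (u ⊛ (poly (- (+ 1) ∷ + 1 ∷ []) ⊛ poly (+ 1 ∷ + 1 ∷ []) ⊛ poly (+ 1 ∷ + 1 ∷ [])))
      ≈ˢ oneˢ →
    (v ⊛ poly (+ 1 ∷ + 1 ∷ [])) ≈ˢ poly (+ 0 ∷ + 1 ∷ []) →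
    (p ⊛ (poly (+ 1 ∷ - (+ 1) ∷ []) ⊛ poly (+ 1 ∷ + 2 ∷ [])))
      ≈ˢ poly (+ 1 ∷ + 1 ∷ []) →
    (q ⊛ poly (+ 1 ∷ + 2 ∷ [])) ≈ˢ poly (+ 0 ∷ + 1 ∷ []) →
    ∀ n k →
      (almostRiordan a u v ⊠ almostRiordan a u v) n k ≡ riordan p q n k
mainTheorem15 a u v p q a-eq u-eq v-eq p-eq q-eq =
  Recurrence-unique (SquareRecurrence.square-recurrence A-recurrence)
                    (riordan-recurrence (+ 2) (+ 2) p q (proj₁ p-coeffs) (proj₂ p-coeffs) q-eq)
  where
  a-coeffs = quotient-coefficients (+ 1) (+ 2) a a-eq
  p-coeffs = quotient-coefficients (+ 2) (+ 1) p p-eq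
  A-recurrence : Recurrence (+ 1) (+ 3) (impulse (- (+ 2))) (almostRiordan a u v)
  A-recurrence =
    almostRiordan-recurrence (+ 1) (+ 3) (- (+ 2)) a u v (proj₁ a-coeffs) (proj₂ a-coeffs)
      (u⊛[1+x]≈a-2 a u (proj₁ a-coeffs) (proj₂ a-coeffs) u-eq) v-eq
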